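{- Let $p$ be a prime and $r\ge1$ an integer. If $f,g\in\mathbb{Q}[x]$ are $p^r$-pure with $\deg(f)>1$, then $f\circ g$ is $p^r$-pure.
   Context: $\nu_p$ denotes the $p$-adic valuation on $\mathbb{Q}$ (with $\nu_p(0)=\infty$). A polynomial $q(x)=a_nx^n+\dots+a_0\in\mathbb{Q}[x]$ of degree $n$ is $p^r$-pure if $\nu_p(a_n)=0$, $\nu_p(a_0)=r$, and $\frac{\nu_p(a_i)}{n-i}\ge\frac{r}{n}$ for all $1\le i\le n-1$. -}

module Defs where

open import Data.Nat as ℕ using (ℕ; zero; suc; _∸_; _^_)
open import Data.Nat.Divisibility using (_∣_)
open import Data.Integer as ℤ using (ℤ; +_; ∣_∣)
open import Data.Rational as ℚ using (ℚ; 0ℚ)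
open import Data.List using (List; []; _∷_; map)
open import Data.Product using (Σ; _×_)
open import Data.Sum using (_⊎_)
open import Relation.Nullary using (¬_)
open import Relation.Binary.PropositionalEquality using (_≡_; _≢_)

-- ValNat p m k : ν_p(m) = k for a natural number m (m ≠ 0 is forced
-- by the second conjunct when p ≥ 2).
ValNat : ℕ → ℕ → ℕ → Set
ValNat p m k = (p ^ k ∣ m) × ¬ (p ^ suc k ∣ m)

ValQ : ℕ → ℚ → ℤ → Set
ValQ p a v =
  (a ≢ 0ℚ) ×
  Σ ℕ (λ k → Σ ℕ (λ l →
    ValNat p ∣ ℚ.numerator a ∣ k × ValNat p (ℚ.denominatorℕ a) l ×
    (v ≡ (+ k) ℤ.- (+ l))))

-- Polynomials over ℚ as coefficient lists [a₀, a₁, …] (trailing zeros allowed)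

Poly : Set
Poly = List ℚ

coeff : Poly → ℕ → ℚ
coeff []       _       = 0ℚ
coeff (a ∷ _)  zero    = a
coeff (_ ∷ q)  (suc i) = coeff q i

HasDegree : Poly → ℕ → Set
HasDegree q n = (coeff q n ≢ 0ℚ) × (∀ m → n ℕ.< m → coeff q m ≡ 0ℚ)

infixl 6 _+ₚ_
infixl 7 _*ₚ_

_+ₚ_ : Poly → Poly → Poly
[]      +ₚ q       = q
(a ∷ f) +ₚ []      = a ∷ f
(a ∷ f) +ₚ (b ∷ g) = (a ℚ.+ b) ∷ (f +ₚ g)

scale : ℚ → Poly → Poly
scale c = map (c ℚ.*_)

_*ₚ_ : Poly → Poly → Poly
[]      *ₚ g = []
(a ∷ f) *ₚ g = scale a g +ₚ (0ℚ ∷ (f *ₚ g))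

compose : Poly → Poly → Poly
compose []      g = []
compose (a ∷ f) g = (a ∷ []) +ₚ (g *ₚ compose f g)

-- ν_p(a_i)/(n−i) ≥ r/n, with ν_p(0) = ∞ (cross-multiplied; n−i, n > 0).
SlopeOK : ℕ → ℕ → ℕ → ℕ → ℚ → Set
SlopeOK p r n i a =
  (a ≡ 0ℚ) ⊎ Σ ℤ (λ v → ValQ p a v × ((+ r) ℤ.* (+ (n ∸ i)) ℤ.≤ (+ n) ℤ.* v))

Pure : ℕ → ℕ → Poly → Set
Pure p r q = Σ ℕ (λ n →
  HasDegree q n ×
  ValQ p (coeff q n) (+ 0) ×
  ValQ p (coeff q 0) (+ r) ×
  (∀ i → 1 ℕ.≤ i → i ℕ.< n → SlopeOK p r n i (coeff q i)))

-- Purity of q of degree n says n·ν_p(q_k) + r·k ≥ r·n for every k, with equality at k = 0 and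
-- k = n.  With N = deg f · deg g, bounds of the form N·ν_p(c_k) + B·k + e ≥ W ("the Newton
-- polygon lies above a line") add up under products of polynomials, so Horner's scheme
-- f(g) = f₀ + g·(f₁ + g·(f₂ + …)) gives N·ν_p(c_k) + r·k ≥ r·N for every coefficient c_k of f∘g.
-- The leading coefficient of f∘g is f_n·(g_m)ⁿ, a p-adic unit.  The constant coefficient is
-- f₀ + h₀·g₀ with h = f₁ + f₂·g + …; the same bound for h, shifted by one step of Horner's
-- scheme, forces ν_p(h₀) ≥ 1 as soon as deg f > 1, so ν_p(c₀) = ν_p(f₀) = r.

module Submission where

open import Defs
open import Data.Nat using (ℕ; _≤_; _<_)
open import Data.Nat.Primality using (Prime; prime⇒nonZero; prime⇒nonTrivial; euclidsLemma)
open import Data.Nat as ℕ using (zero; suc; _∸_; _^_; z≤n; s≤s; NonZero)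
import Data.Nat.Properties as ℕP
open import Data.Nat.Divisibility
open import Data.Nat.Induction using (<-rec)
open import Data.Nat.Tactic.RingSolver using (solve)
open import Data.Integer as ℤ using (ℤ; +_; -[1+_]; ∣_∣)
import Data.Integer.Properties as ℤP
import Data.Integer.Divisibility.Signed as ℤD
open import Data.Integer.Tactic.RingSolver using (solve-∀)
open import Data.Rational as ℚ using (ℚ; 0ℚ; 1ℚ; ↥_; ↧_; ↧ₙ_)
import Data.Rational.Properties as ℚP
import Data.Rational.Unnormalised as ℚᵘ
import Data.Rational.Unnormalised.Properties as ℚᵘP
open import Algebra.Bundles using (CommutativeMonoid)
open import Algebra.Definitions.RawSemiring ℚP.+-*-rawSemiring using () renaming (_^_ to _^ℚ_)
import Algebra.Properties.CommutativeSemigroup ℕP.+-commutativeSemigroup as ℕ+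
import Algebra.Properties.CommutativeSemigroup ℕP.*-commutativeSemigroup as ℕ*
import Algebra.Properties.CommutativeSemigroup ℤP.*-commutativeSemigroup as ℤ*
import Algebra.Properties.CommutativeSemigroup (CommutativeMonoid.commutativeSemigroup ℚP.*-1-commutativeMonoid) as ℚ*
open import Data.List using ([]; _∷_)
open import Data.Product using (Σ; _×_; _,_; proj₁; proj₂)
open import Data.Sum using (inj₁; inj₂; [_,_])
open import Data.Empty using (⊥-elim)
open import Function using (_∘_; _$_)
open import Relation.Nullary using (yes; no; ¬_)
open import Relation.Binary.Definitions using (tri<; tri≈; tri>)
open import Relation.Binary.PropositionalEquality hiding ([_])

coeff-+ₚ : ∀ q s k → coeff (q +ₚ s) k ≡ coeff q k ℚ.+ coeff s k
coeff-+ₚ []      s       k       = sym (ℚP.+-identityˡ (coeff s k))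
coeff-+ₚ (a ∷ q) []      k       = sym (ℚP.+-identityʳ (coeff (a ∷ q) k))
coeff-+ₚ (a ∷ q) (b ∷ s) zero    = refl
coeff-+ₚ (a ∷ q) (b ∷ s) (suc k) = coeff-+ₚ q s k

coeff-const+ₚ-suc : ∀ a s k → coeff ((a ∷ []) +ₚ s) (suc k) ≡ coeff s (suc k)
coeff-const+ₚ-suc a []      k = refl
coeff-const+ₚ-suc a (b ∷ s) k = refl

coeff-scale : ∀ c s k → coeff (scale c s) k ≡ c ℚ.* coeff s k
coeff-scale c []      k       = sym (ℚP.*-zeroʳ c)
coeff-scale c (b ∷ s) zero    = refl
coeff-scale c (b ∷ s) (suc k) = coeff-scale c s k

coeff-∷*ₚ : ∀ a q s k → coeff ((a ∷ q) *ₚ s) k ≡ a ℚ.* coeff s k ℚ.+ coeff (0ℚ ∷ (q *ₚ s)) k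
coeff-∷*ₚ a q s k =
  trans (coeff-+ₚ (scale a s) (0ℚ ∷ (q *ₚ s)) k) (cong (ℚ._+ _) (coeff-scale a s k))

coeff-*ₚ-0 : ∀ q s → coeff (q *ₚ s) 0 ≡ coeff q 0 ℚ.* coeff s 0
coeff-*ₚ-0 []      s = sym (ℚP.*-zeroˡ (coeff s 0))
coeff-*ₚ-0 (a ∷ q) s = trans (coeff-∷*ₚ a q s 0) (ℚP.+-identityʳ _)

coeff-compose-0 : ∀ a L g →
  coeff (compose (a ∷ L) g) 0 ≡ a ℚ.+ coeff (compose L g) 0 ℚ.* coeff g 0
coeff-compose-0 a L g = trans (coeff-+ₚ (a ∷ []) (g *ₚ compose L g) 0)
  (cong (a ℚ.+_) (trans (coeff-*ₚ-0 g (compose L g)) (ℚP.*-comm (coeff g 0) _)))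

Vanishes : Poly → Set
Vanishes q = ∀ k → coeff q k ≡ 0ℚ

vanishes-∷ : ∀ {q} → Vanishes q → Vanishes (0ℚ ∷ q)
vanishes-∷ z zero    = refl
vanishes-∷ z (suc k) = z k

vanishes-+ₚ : ∀ {q s} → Vanishes q → Vanishes s → Vanishes (q +ₚ s)
vanishes-+ₚ {q} {s} zq zs k =
  trans (coeff-+ₚ q s k) (trans (cong₂ ℚ._+_ (zq k) (zs k)) (ℚP.+-identityʳ 0ℚ))

0+0≡0 : ∀ {x y} → x ≡ 0ℚ → y ≡ 0ℚ → x ℚ.+ y ≡ 0ℚ
0+0≡0 refl refl = ℚP.+-identityʳ 0ℚ

vanishes-*ₚˡ : ∀ q {s} → Vanishes q → Vanishes (q *ₚ s)
vanishes-*ₚˡ []      z k = refl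
vanishes-*ₚˡ (a ∷ q) {s} z k = trans (coeff-∷*ₚ a q s k) (0+0≡0
  (trans (cong (ℚ._* coeff s k) (z 0)) (ℚP.*-zeroˡ (coeff s k)))
  (vanishes-∷ (vanishes-*ₚˡ q (z ∘ suc)) k))

vanishes-*ₚʳ : ∀ q {s} → Vanishes s → Vanishes (q *ₚ s)
vanishes-*ₚʳ []      z k = refl
vanishes-*ₚʳ (a ∷ q) {s} z k = trans (coeff-∷*ₚ a q s k) (0+0≡0
  (trans (cong (a ℚ.*_) (z k)) (ℚP.*-zeroʳ a))
  (vanishes-∷ (vanishes-*ₚʳ q z) k))

vanishes-compose : ∀ L g → Vanishes L → Vanishes (compose L g)
vanishes-compose []      g z k = refl
vanishes-compose (a ∷ L) g z =
  vanishes-+ₚ {a ∷ []} {g *ₚ compose L g} const (vanishes-*ₚʳ g (vanishes-compose L g (z ∘ suc)))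
  where
  const : Vanishes (a ∷ [])
  const zero    = z 0
  const (suc k) = refl

TopCoeff : Poly → ℕ → ℚ → Set
TopCoeff q d c = (coeff q d ≡ c) × (∀ k → d < k → coeff q k ≡ 0ℚ)

topCoeff-*ₚ : ∀ q {s d e c c′} → TopCoeff q d c → TopCoeff s e c′ →
  TopCoeff (q *ₚ s) (d ℕ.+ e) (c ℚ.* c′)
topCoeff-*ₚ [] {c′ = c′} (refl , _) _ = sym (ℚP.*-zeroˡ c′) , λ _ _ → refl
topCoeff-*ₚ (a ∷ q) {s} {zero} {e} (refl , high) (top′ , high′) =
  trans (coeff-∷*ₚ a q s e)
    (trans (cong (a ℚ.* coeff s e ℚ.+_) (tail e)) (trans (ℚP.+-identityʳ _) (cong (a ℚ.*_) top′))) ,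
  λ k e<k → trans (coeff-∷*ₚ a q s k) (0+0≡0 (trans (cong (a ℚ.*_) (high′ k e<k)) (ℚP.*-zeroʳ a)) (tail k))
  where
  tail : Vanishes (0ℚ ∷ (q *ₚ s))
  tail = vanishes-∷ (vanishes-*ₚˡ q (λ k → high (suc k) (s≤s z≤n)))
topCoeff-*ₚ (a ∷ q) {s} {suc d} {e} {c} {c′} (top , high) (top′ , high′) =
  trans (coeff-∷*ₚ a q s (suc (d ℕ.+ e))) (trans (cong (ℚ._+ _) (a*beyond≡0 (ℕP.m≤n+m e d)))
    (trans (ℚP.+-identityˡ _) (proj₁ ih))) ,
  λ { (suc k) (s≤s d+e<k) → trans (coeff-∷*ₚ a q s (suc k))
        (0+0≡0 (a*beyond≡0 (ℕP.≤-trans (ℕP.m≤n+m e d) (ℕP.<⇒≤ d+e<k))) (proj₂ ih k d+e<k)) }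
  where
  ih : TopCoeff (q *ₚ s) (d ℕ.+ e) (c ℚ.* c′)
  ih = topCoeff-*ₚ q (top , λ k d<k → high (suc k) (s≤s d<k)) (top′ , high′)
  a*beyond≡0 : ∀ {k} → e ≤ k → a ℚ.* coeff s (suc k) ≡ 0ℚ
  a*beyond≡0 e≤k = trans (cong (a ℚ.*_) (high′ _ (s≤s e≤k))) (ℚP.*-zeroʳ a)

topCoeff-compose : ∀ g {m b} → TopCoeff g (suc m) b → ∀ L d {c} → TopCoeff L d c →
  TopCoeff (compose L g) (d ℕ.* suc m) (c ℚ.* b ^ℚ d)
topCoeff-compose _ {b = b} _ [] d {c} (refl , _) = sym (ℚP.*-zeroˡ (b ^ℚ d)) , λ _ _ → refl
topCoeff-compose g {m} {b} _ (a ∷ L) zero {c} (refl , high) =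
  trans (coeff-+ₚ (a ∷ []) (g *ₚ compose L g) 0)
    (trans (cong (a ℚ.+_) (rest 0)) (trans (ℚP.+-identityʳ a) (sym (ℚP.*-identityʳ a)))) ,
  λ { (suc k) _ → trans (coeff-const+ₚ-suc a (g *ₚ compose L g) k) (rest (suc k)) }
  where
  rest : Vanishes (g *ₚ compose L g)
  rest = vanishes-*ₚʳ g (vanishes-compose L g (λ k → high (suc k) (s≤s z≤n)))
topCoeff-compose g {m} {b} tg (a ∷ L) (suc d) {c} (top , high) =
  trans (coeff-const+ₚ-suc a (g *ₚ compose L g) (m ℕ.+ d ℕ.* suc m))
    (trans (proj₁ prod) (ℚ*.x∙yz≈y∙xz b c (b ^ℚ d))) ,
  λ { (suc k) M<k → trans (coeff-const+ₚ-suc a (g *ₚ compose L g) k) (proj₂ prod (suc k) M<k) }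
  where
  prod : TopCoeff (g *ₚ compose L g) (suc m ℕ.+ d ℕ.* suc m) (b ℚ.* (c ℚ.* b ^ℚ d))
  prod = topCoeff-*ₚ g tg (topCoeff-compose g tg L d (top , λ k d<k → high (suc k) (s≤s d<k)))

module _ where

  open import Data.Integer using (_+_; _*_; _-_; -_)

  factor-sign : ∀ i q m → ∣ i ∣ ≡ q ℕ.* m → Σ ℤ λ u → ∣ u ∣ ≡ q × i ≡ u * + m
  factor-sign (+ _)    q m eq = + q , refl , trans (cong +_ eq) (ℤP.pos-* q m)
  factor-sign -[1+ _ ] q m eq = - + q , ℤP.∣-i∣≡∣i∣ (+ q) ,
    trans (cong -_ (trans (cong +_ eq) (ℤP.pos-* q m))) (ℤP.neg-distribˡ-* (+ q) (+ m))

  +∸≡+-+ : ∀ {k l} → l ≤ k → + (k ∸ l) ≡ + k - + l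
  +∸≡+-+ {k} {l} l≤k = sym (trans (ℤP.m-n≡m⊖n k l) (ℤP.⊖-≥ l≤k))

  -- ℚ.toℚᵘ does not reduce on a variable; η-expanding it exposes ↥ and ↧ in toℚᵘ-homo-+/*.
  toℚᵘ-η : ∀ a → ℚ.toℚᵘ a ≡ ℚᵘ.mkℚᵘ (↥ a) (ℚ.denominator-1 a)
  toℚᵘ-η record{} = refl

  ↥↧-+ : ∀ a b → ↥ (a ℚ.+ b) * (↧ a * ↧ b) ≡ (↥ a * ↧ b + ↥ b * ↧ a) * ↧ (a ℚ.+ b)
  ↥↧-+ a b
    with ℚ.toℚᵘ a | toℚᵘ-η a | ℚ.toℚᵘ b | toℚᵘ-η b | ℚ.toℚᵘ (a ℚ.+ b) | toℚᵘ-η (a ℚ.+ b) | ℚP.toℚᵘ-homo-+ a b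
  ... | _ | refl | _ | refl | _ | refl | eq = ℚᵘP.drop-*≡* eq

  ↥↧-* : ∀ a b → ↥ (a ℚ.* b) * (↧ a * ↧ b) ≡ (↥ a * ↥ b) * ↧ (a ℚ.* b)
  ↥↧-* a b
    with ℚ.toℚᵘ a | toℚᵘ-η a | ℚ.toℚᵘ b | toℚᵘ-η b | ℚ.toℚᵘ (a ℚ.* b) | toℚᵘ-η (a ℚ.* b) | ℚP.toℚᵘ-homo-* a b
  ... | _ | refl | _ | refl | _ | refl | eq = ℚᵘP.drop-*≡* eq

module PAdic {p : ℕ} (p-prime : Prime p) where

  open import Data.Integer using (_+_; _*_; _-_)

  instance
    p≢0 : NonZero p
    p≢0 = prime⇒nonZero p-prime

  p^≢0 : ∀ t → NonZero (p ^ t)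
  p^≢0 t = ℕP.m^n≢0 p t

  1<p : 1 < p
  1<p = ℕ.nonTrivial⇒n>1 p {{prime⇒nonTrivial p-prime}}

  p∤1 : p ∤ 1
  p∤1 p∣1 = ℕP.<⇒≱ 1<p (∣⇒≤ p∣1)

  ∤-* : ∀ {m n} → p ∤ m → p ∤ n → p ∤ m ℕ.* n
  ∤-* p∤m p∤n = [ p∤m , p∤n ] ∘ euclidsLemma _ _ p-prime

  ^-monoʳ-∣ : ∀ {s t} → s ≤ t → p ^ s ∣ p ^ t
  ^-monoʳ-∣ {t = t} z≤n = 1∣ (p ^ t)
  ^-monoʳ-∣ (s≤s s≤t)   = *-monoʳ-∣ p (^-monoʳ-∣ s≤t)

  p^∣m*n⇒p^∣m : ∀ e {m n} → p ∤ n → p ^ e ∣ m ℕ.* n → p ^ e ∣ m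
  p^∣m*n⇒p^∣m zero    {m} _ _ = 1∣ m
  p^∣m*n⇒p^∣m (suc e) {m} {n} p∤n p^1+e∣mn
    with p^∣m*n⇒p^∣m e {m} p∤n (∣-trans (n∣m*n p) p^1+e∣mn)
  ... | divides q refl = [ *-monoˡ-∣ (p ^ e) , ⊥-elim ∘ p∤n ] (euclidsLemma q n p-prime p∣qn)
    where
    p∣qn : p ∣ q ℕ.* n
    p∣qn = *-cancelˡ-∣ (p ^ e) {{p^≢0 e}}
      (subst₂ _∣_ (ℕP.*-comm p (p ^ e)) (ℕ*.xy∙z≈y∙xz q (p ^ e) n) p^1+e∣mn)

  valNat-exists : ∀ m → m ≢ 0 → Σ ℕ (ValNat p m)
  valNat-exists = <-rec _ step
    where
    step : ∀ m → (∀ {q} → q < m → q ≢ 0 → Σ ℕ (ValNat p q)) → m ≢ 0 → Σ ℕ (ValNat p m)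
    step m rec m≢0 with p ∣? m
    ... | no p∤m = 0 , 1∣ m , p∤m ∘ subst (_∣ m) (ℕP.*-identityʳ p)
    ... | yes (divides q refl) = extend (rec (ℕP.m<m*n q p {{ℕ.≢-nonZero q≢0}} 1<p) q≢0)
      where
      q≢0 : q ≢ 0
      q≢0 q≡0 = m≢0 (cong (ℕ._* p) q≡0)
      extend : Σ ℕ (ValNat p q) → Σ ℕ (ValNat p (q ℕ.* p))
      extend (k , p^k∣q , p^1+k∤q) =
        suc k ,
        subst (_∣ q ℕ.* p) (ℕP.*-comm (p ^ k) p) (*-monoˡ-∣ p p^k∣q) ,
        p^1+k∤q ∘ *-cancelˡ-∣ p ∘ subst (p ℕ.* p ^ suc k ∣_) (ℕP.*-comm q p)

  valNat-maximal : ∀ {m k j} → ValNat p m k → p ^ j ∣ m → j ≤ k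
  valNat-maximal {k = k} {j} (_ , p^1+k∤m) p^j∣m with j ℕP.≤? k
  ... | yes j≤k = j≤k
  ... | no  j≰k = ⊥-elim (p^1+k∤m (∣-trans (^-monoʳ-∣ (ℕP.≰⇒> j≰k)) p^j∣m))

  valNat-unique : ∀ {m k l} → ValNat p m k → ValNat p m l → k ≡ l
  valNat-unique {k = k} {l} νk νl =
    ℕP.≤-antisym (valNat-maximal {k = l} νl (proj₁ νk)) (valNat-maximal {k = k} νk (proj₁ νl))

  valQ-unique : ∀ {a v v′} → ValQ p a v → ValQ p a v′ → v ≡ v′
  valQ-unique (_ , k , l , νk , νl , refl) (_ , k′ , l′ , νk′ , νl′ , refl) =
    cong₂ (λ k l → + k - + l) (valNat-unique {k = k} {k′} νk νk′) (valNat-unique {k = l} {l′} νl νl′)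

  p^ᶻ : ℕ → ℤ
  p^ᶻ t = + (p ^ t)

  p^ᶻ-+ : ∀ s t → p^ᶻ (s ℕ.+ t) ≡ p^ᶻ s * p^ᶻ t
  p^ᶻ-+ s t = trans (cong +_ (ℕP.^-distribˡ-+-* p s t)) (ℤP.pos-* (p ^ s) (p ^ t))

  -- t ≤ ν_p(a), witnessed by a = u·p^t/w with p ∤ w, cleared of the denominator of a.
  record ValAtLeast (t : ℕ) (a : ℚ) : Set where
    constructor valAtLeast
    field
      u       : ℤ
      w       : ℕ
      w-∤     : p ∤ w
      cleared : ↥ a * + w ≡ u * p^ᶻ t * ↧ a

  record ValExactly (t : ℕ) (a : ℚ) : Set where
    constructor valExactly
    field
      atLeast : ValAtLeast t a
      u-∤     : p ∤ ∣ ValAtLeast.u atLeast ∣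

  private instance
    ↧*↧≢0 : ∀ {a b} → ℤ.NonZero (↧ a * ↧ b)
    ↧*↧≢0 {a} {b} = ℤP.i*j≢0 (↧ a) (↧ b)

  valAtLeast-+ : ∀ {t a b} → ValAtLeast t a → ValAtLeast t b → ValAtLeast t (a ℚ.+ b)
  valAtLeast-+ {t} {a} {b} (valAtLeast u₁ w₁ p∤w₁ eq₁) (valAtLeast u₂ w₂ p∤w₂ eq₂) =
    valAtLeast (u₁ * + w₂ + u₂ * + w₁) (w₁ ℕ.* w₂) (∤-* p∤w₁ p∤w₂) $
      trans (cong (↥ (a ℚ.+ b) *_) (ℤP.pos-* w₁ w₂)) (ℤP.*-cancelʳ-≡ _ _ (↧ a * ↧ b) (begin
        ↥ (a ℚ.+ b) * (+ w₁ * + w₂) * (↧ a * ↧ b)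
          ≡⟨ ℤ*.xy∙z≈xz∙y (↥ (a ℚ.+ b)) (+ w₁ * + w₂) (↧ a * ↧ b) ⟩
        ↥ (a ℚ.+ b) * (↧ a * ↧ b) * (+ w₁ * + w₂)
          ≡⟨ cong (_* (+ w₁ * + w₂)) (↥↧-+ a b) ⟩
        (↥ a * ↧ b + ↥ b * ↧ a) * ↧ (a ℚ.+ b) * (+ w₁ * + w₂)
          ≡⟨ expand (↥ a) (↥ b) (↧ a) (↧ b) (↧ (a ℚ.+ b)) (+ w₁) (+ w₂) ⟩
        ((↥ a * + w₁) * (↧ b * + w₂) + (↥ b * + w₂) * (↧ a * + w₁)) * ↧ (a ℚ.+ b)
          ≡⟨ cong₂ (λ x y → (x * (↧ b * + w₂) + y * (↧ a * + w₁)) * ↧ (a ℚ.+ b)) eq₁ eq₂ ⟩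
        ((u₁ * p^ᶻ t * ↧ a) * (↧ b * + w₂) + (u₂ * p^ᶻ t * ↧ b) * (↧ a * + w₁)) * ↧ (a ℚ.+ b)
          ≡⟨ collect u₁ u₂ (p^ᶻ t) (↧ a) (↧ b) (↧ (a ℚ.+ b)) (+ w₁) (+ w₂) ⟩
        (u₁ * + w₂ + u₂ * + w₁) * p^ᶻ t * ↧ (a ℚ.+ b) * (↧ a * ↧ b) ∎))
      where
      open ≡-Reasoning
      expand : ∀ na nb da db ds w₁ w₂ → (na * db + nb * da) * ds * (w₁ * w₂) ≡
        ((na * w₁) * (db * w₂) + (nb * w₂) * (da * w₁)) * ds
      expand = solve-∀
      collect : ∀ u₁ u₂ q da db ds w₁ w₂ →
        ((u₁ * q * da) * (db * w₂) + (u₂ * q * db) * (da * w₁)) * ds ≡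
        (u₁ * w₂ + u₂ * w₁) * q * ds * (da * db)
      collect = solve-∀

  valAtLeast-* : ∀ {s t a b} → ValAtLeast s a → ValAtLeast t b → ValAtLeast (s ℕ.+ t) (a ℚ.* b)
  valAtLeast-* {s} {t} {a} {b} (valAtLeast u₁ w₁ p∤w₁ eq₁) (valAtLeast u₂ w₂ p∤w₂ eq₂) =
    valAtLeast (u₁ * u₂) (w₁ ℕ.* w₂) (∤-* p∤w₁ p∤w₂) $
      trans (cong (↥ (a ℚ.* b) *_) (ℤP.pos-* w₁ w₂)) (ℤP.*-cancelʳ-≡ _ _ (↧ a * ↧ b) (begin
        ↥ (a ℚ.* b) * (+ w₁ * + w₂) * (↧ a * ↧ b)
          ≡⟨ ℤ*.xy∙z≈xz∙y (↥ (a ℚ.* b)) (+ w₁ * + w₂) (↧ a * ↧ b) ⟩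
        ↥ (a ℚ.* b) * (↧ a * ↧ b) * (+ w₁ * + w₂)
          ≡⟨ cong (_* (+ w₁ * + w₂)) (↥↧-* a b) ⟩
        (↥ a * ↥ b) * ↧ (a ℚ.* b) * (+ w₁ * + w₂)
          ≡⟨ regroup (↥ a) (↥ b) (↧ (a ℚ.* b)) (+ w₁) (+ w₂) ⟩
        (↥ a * + w₁) * (↥ b * + w₂) * ↧ (a ℚ.* b)
          ≡⟨ cong₂ (λ x y → x * y * ↧ (a ℚ.* b)) eq₁ eq₂ ⟩
        (u₁ * p^ᶻ s * ↧ a) * (u₂ * p^ᶻ t * ↧ b) * ↧ (a ℚ.* b)
          ≡⟨ collect u₁ u₂ (p^ᶻ s) (p^ᶻ t) (↧ a) (↧ b) (↧ (a ℚ.* b)) ⟩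
        (u₁ * u₂) * (p^ᶻ s * p^ᶻ t) * ↧ (a ℚ.* b) * (↧ a * ↧ b)
          ≡⟨ cong (λ z → (u₁ * u₂) * z * ↧ (a ℚ.* b) * (↧ a * ↧ b)) (sym (p^ᶻ-+ s t)) ⟩
        (u₁ * u₂) * p^ᶻ (s ℕ.+ t) * ↧ (a ℚ.* b) * (↧ a * ↧ b) ∎))
      where
      open ≡-Reasoning
      regroup : ∀ na nb d w₁ w₂ → (na * nb) * d * (w₁ * w₂) ≡ (na * w₁) * (nb * w₂) * d
      regroup = solve-∀
      collect : ∀ u₁ u₂ q₁ q₂ da db d →
        (u₁ * q₁ * da) * (u₂ * q₂ * db) * d ≡ (u₁ * u₂) * (q₁ * q₂) * d * (da * db)
      collect = solve-∀

  valAtLeast-0ℚ : ∀ t → ValAtLeast t 0ℚ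
  valAtLeast-0ℚ t = valAtLeast (+ 0) 1 p∤1 refl

  valAtLeast-≤ : ∀ {s t a} → s ≤ t → ValAtLeast t a → ValAtLeast s a
  valAtLeast-≤ {s} {t} {a} s≤t (valAtLeast u w p∤w eq) = valAtLeast (u * p^ᶻ (t ∸ s)) w p∤w (begin
    ↥ a * + w                        ≡⟨ eq ⟩
    u * p^ᶻ t * ↧ a                  ≡⟨ cong (λ e → u * p^ᶻ e * ↧ a) (sym (ℕP.m+[n∸m]≡n s≤t)) ⟩
    u * p^ᶻ (s ℕ.+ (t ∸ s)) * ↧ a    ≡⟨ cong (λ z → u * z * ↧ a) (p^ᶻ-+ s (t ∸ s)) ⟩
    u * (p^ᶻ s * p^ᶻ (t ∸ s)) * ↧ a  ≡⟨ cong (_* ↧ a) (ℤ*.x∙yz≈xz∙y u (p^ᶻ s) (p^ᶻ (t ∸ s))) ⟩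
    u * p^ᶻ (t ∸ s) * p^ᶻ s * ↧ a    ∎)
    where open ≡-Reasoning

  valExactly-* : ∀ {s t a b} → ValExactly s a → ValExactly t b → ValExactly (s ℕ.+ t) (a ℚ.* b)
  valExactly-* (valExactly ν₁ p∤u₁) (valExactly ν₂ p∤u₂) =
    valExactly (valAtLeast-* ν₁ ν₂)
      (subst (p ∤_) (sym (ℤP.abs-* (ValAtLeast.u ν₁) (ValAtLeast.u ν₂))) (∤-* p∤u₁ p∤u₂))

  valExactly-1ℚ : ValExactly 0 1ℚ
  valExactly-1ℚ = valExactly (valAtLeast (+ 1) 1 p∤1 refl) p∤1

  valExactly-^ : ∀ {b} d → ValExactly 0 b → ValExactly 0 (b ^ℚ d)
  valExactly-^ zero    _ = valExactly-1ℚ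
  valExactly-^ (suc d) ν = valExactly-* ν (valExactly-^ d ν)

  valExactly-+ : ∀ {t a b} → ValExactly t a → ValAtLeast (suc t) b → ValExactly t (a ℚ.+ b)
  valExactly-+ {t} {a} {b} (valExactly ν₁@(valAtLeast u₁ w₁ _ _) p∤u₁) (valAtLeast u₂ w₂ p∤w₂ eq₂) =
    valExactly (valAtLeast-+ {t} {a} {b} ν₁ (valAtLeast (u₂ * + p) w₂ p∤w₂ eq₂′)) p∤sum
    where
    eq₂′ : ↥ b * + w₂ ≡ u₂ * + p * p^ᶻ t * ↧ b
    eq₂′ = trans eq₂
      (cong (_* ↧ b) (trans (cong (u₂ *_) (ℤP.pos-* p (p ^ t))) (sym (ℤP.*-assoc u₂ (+ p) (p^ᶻ t)))))
    p∣pw₁ : + p ℤD.∣ u₂ * + p * + w₁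
    p∣pw₁ = ℤD.∣m⇒∣m*n (+ w₁) (ℤD.∣n⇒∣m*n u₂ (ℤD.∣-refl {+ p}))
    p∤sum : p ∤ ∣ u₁ * + w₂ + u₂ * + p * + w₁ ∣
    p∤sum p∣sum = ∤-* p∤u₁ p∤w₂ (subst (p ∣_) (ℤP.abs-* u₁ (+ w₂))
      (ℤD.∣⇒∣ᵤ (ℤD.∣m+n∣n⇒∣m {+ p} {u₁ * + w₂} (ℤD.∣ᵤ⇒∣ p∣sum) p∣pw₁)))

  private
    ∣cleared∣ : ∀ {t a} (ν : ValAtLeast t a) →
      ∣ ↥ a ∣ ℕ.* ValAtLeast.w ν ≡ ∣ ValAtLeast.u ν ∣ ℕ.* p ^ t ℕ.* ↧ₙ a
    ∣cleared∣ {t} {a} (valAtLeast u w _ eq) = begin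
      ∣ ↥ a ∣ ℕ.* w             ≡⟨ ℤP.abs-* (↥ a) (+ w) ⟨
      ∣ ↥ a * + w ∣             ≡⟨ cong ∣_∣ eq ⟩
      ∣ u * p^ᶻ t * ↧ a ∣       ≡⟨ ℤP.abs-* (u * p^ᶻ t) (↧ a) ⟩
      ∣ u * p^ᶻ t ∣ ℕ.* ↧ₙ a    ≡⟨ cong (ℕ._* ↧ₙ a) (ℤP.abs-* u (p^ᶻ t)) ⟩
      ∣ u ∣ ℕ.* p ^ t ℕ.* ↧ₙ a  ∎
      where open ≡-Reasoning

  valAtLeast⇒p^∣↥ : ∀ {t l a} → ValAtLeast t a → p ^ l ∣ ↧ₙ a → p ^ (t ℕ.+ l) ∣ ∣ ↥ a ∣
  valAtLeast⇒p^∣↥ {t} {l} {a} ν@(valAtLeast u w p∤w _) p^l∣↧a =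
    p^∣m*n⇒p^∣m (t ℕ.+ l) p∤w (subst (p ^ (t ℕ.+ l) ∣_) (sym (∣cleared∣ ν)) (subst₂ _∣_
      (sym (ℕP.^-distribˡ-+-* p t l)) (sym (ℕP.*-assoc ∣ u ∣ (p ^ t) (↧ₙ a)))
      (∣n⇒∣m*n ∣ u ∣ (*-monoʳ-∣ (p ^ t) p^l∣↧a))))

  valAtLeast⇒valQ : ∀ {t a} → ValAtLeast t a → a ≢ 0ℚ → Σ ℕ λ s → t ≤ s × ValQ p a (+ s)
  valAtLeast⇒valQ {t} {a} ν a≢0
    with valNat-exists ∣ ↥ a ∣ (a≢0 ∘ ℚP.↥p≡0⇒p≡0 a ∘ ℤP.∣i∣≡0⇒i≡0) | valNat-exists (↧ₙ a) (λ ())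
  ... | k , νk | l , νl =
    k ∸ l , ℕP.m+n≤o⇒m≤o∸n t t+l≤k , a≢0 , k , l , νk , νl , +∸≡+-+ (ℕP.≤-trans (ℕP.m≤n+m l t) t+l≤k)
    where
    t+l≤k : t ℕ.+ l ≤ k
    t+l≤k = valNat-maximal {k = k} νk (valAtLeast⇒p^∣↥ ν (proj₁ νl))

  valExactly⇒valQ : ∀ {s a} → ValExactly s a → ValQ p a (+ s)
  valExactly⇒valQ {s} {a} (valExactly ν@(valAtLeast u w _ _) p∤u) with valNat-exists (↧ₙ a) (λ ())
  ... | l , νl@(p^l∣↧a , p^1+l∤↧a) =
    a≢0 , s ℕ.+ l , l , (valAtLeast⇒p^∣↥ ν p^l∣↧a , p^1+s+l∤↥a) , νl ,
    trans (cong +_ (sym (ℕP.m+n∸n≡m s l))) (+∸≡+-+ (ℕP.m≤n+m l s))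
    where
    a≢0 : a ≢ 0ℚ
    a≢0 a≡0 = p∤u (subst (p ∣_) (sym ∣u∣≡0) (p ∣0))
      where
      ∣u∣≡0 : ∣ u ∣ ≡ 0
      ∣u∣≡0 = ℕP.m*n≡0⇒m≡0 ∣ u ∣ (p ^ s) {{p^≢0 s}} (ℕP.m*n≡0⇒m≡0 _ (↧ₙ a)
        (trans (sym (∣cleared∣ ν)) (cong (λ x → ∣ ↥ x ∣ ℕ.* w) a≡0)))
    p^1+s+l∤↥a : p ^ suc (s ℕ.+ l) ∤ ∣ ↥ a ∣
    p^1+s+l∤↥a p^1+s+l∣↥a = p^1+l∤↧a (p^∣m*n⇒p^∣m (suc l) p∤u (*-cancelˡ-∣ (p ^ s) {{p^≢0 s}}
      (subst₂ _∣_
        (trans (cong (p ^_) (sym (ℕP.+-suc s l))) (ℕP.^-distribˡ-+-* p s (suc l)))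
        (trans (∣cleared∣ ν) (ℕ*.xy∙z≈y∙zx ∣ u ∣ (p ^ s) (↧ₙ a)))
        (∣m⇒∣m*n w p^1+s+l∣↥a))))

  valQ⇒valExactly : ∀ {s a} → ValQ p a (+ s) → ValExactly s a
  valQ⇒valExactly {s} {a} (_ , k , l , (divides q ∣↥a∣≡q*p^k , p^1+k∤↥a) , (divides w ↧a≡w*p^l , p^1+l∤↧a) , s≡k-l)
    with factor-sign (↥ a) q (p ^ k) ∣↥a∣≡q*p^k
  ... | u , ∣u∣≡q , ↥a≡u*p^k = valExactly (valAtLeast u w p∤w eq) (subst (p ∤_) (sym ∣u∣≡q) p∤q)
    where
    p∤q : p ∤ q
    p∤q p∣q = p^1+k∤↥a (subst (p ^ suc k ∣_) (sym ∣↥a∣≡q*p^k) (*-monoˡ-∣ (p ^ k) p∣q))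
    p∤w : p ∤ w
    p∤w p∣w = p^1+l∤↧a (subst (p ^ suc l ∣_) (sym ↧a≡w*p^l) (*-monoˡ-∣ (p ^ l) p∣w))
    open ≡-Reasoning
    subtract-add : ∀ i j → i ≡ i - j + j
    subtract-add = solve-∀
    regroup : ∀ x y z v → x * (y * z) * v ≡ x * y * (v * z)
    regroup = solve-∀
    k≡s+l : k ≡ s ℕ.+ l
    k≡s+l = ℤP.+-injective (begin
      + k              ≡⟨ subtract-add (+ k) (+ l) ⟩
      + k - + l + + l  ≡⟨ cong (_+ + l) s≡k-l ⟨
      + s + + l        ≡⟨ ℤP.pos-+ s l ⟨
      + (s ℕ.+ l)      ∎)
    eq : ↥ a * + w ≡ u * p^ᶻ s * ↧ a
    eq = begin
      ↥ a * + w                  ≡⟨ cong (_* + w) ↥a≡u*p^k ⟩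
      u * p^ᶻ k * + w            ≡⟨ cong (λ e → u * p^ᶻ e * + w) k≡s+l ⟩
      u * p^ᶻ (s ℕ.+ l) * + w    ≡⟨ cong (λ z → u * z * + w) (p^ᶻ-+ s l) ⟩
      u * (p^ᶻ s * p^ᶻ l) * + w  ≡⟨ regroup u (p^ᶻ s) (p^ᶻ l) (+ w) ⟩
      u * p^ᶻ s * (+ w * p^ᶻ l)  ≡⟨ cong (u * p^ᶻ s *_) (trans (cong +_ ↧a≡w*p^l) (ℤP.pos-* w (p ^ l))) ⟨
      u * p^ᶻ s * ↧ a            ∎

  valQ⇒valAtLeast : ∀ {s a} → ValQ p a (+ s) → ValAtLeast s a
  valQ⇒valAtLeast = ValExactly.atLeast ∘ valQ⇒valExactly

module NewtonPolygon {p : ℕ} (p-prime : Prime p) where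

  open import Data.Nat using (_+_; _*_)
  open PAdic p-prime

  record Above (A W e : ℕ) (a : ℚ) : Set where
    constructor above
    field
      {t}   : ℕ
      ν≥t   : ValAtLeast t a
      bound : W ≤ A * t + e

  -- Every point (k, ν_p(q_k)) lies on or above the line A·y + B·x + e = W.
  NewtonAbove : (A B : ℕ) → Poly → (W e : ℕ) → Set
  NewtonAbove A B q W e = ∀ k → Above A W (e + k * B) (coeff q k)

  above-0ℚ : ∀ {A W e} .{{_ : NonZero A}} → Above A W e 0ℚ
  above-0ℚ {A} {W} {e} = above (valAtLeast-0ℚ W) (ℕP.≤-trans (ℕP.m≤n*m W A) (ℕP.m≤m+n (A * W) e))

  above-shift : ∀ {A W W′ e e′ a} → Above A W e a → W′ + e ≡ W + e′ → Above A W′ e′ a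
  above-shift {A} {W} {W′} {e} {e′} (above {t} ν W≤) eq =
    above ν (ℕP.+-cancelʳ-≤ e W′ (A * t + e′) (begin
      W′ + e          ≡⟨ eq ⟩
      W + e′          ≤⟨ ℕP.+-monoˡ-≤ e′ W≤ ⟩
      A * t + e + e′  ≡⟨ ℕ+.xy∙z≈xz∙y (A * t) e e′ ⟩
      A * t + e′ + e  ∎))
    where open ℕP.≤-Reasoning

  above-monoᴬ : ∀ {A A′ W e a} → A ≤ A′ → Above A W e a → Above A′ W e a
  above-monoᴬ {e = e} A≤A′ (above {t} ν W≤) =
    above ν (ℕP.≤-trans W≤ (ℕP.+-monoˡ-≤ e (ℕP.*-monoˡ-≤ t A≤A′)))

  above-scale : ∀ {A W e a} m → Above A W e a → Above (A * m) (W * m) (e * m) a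
  above-scale {A} {W} {e} m (above {t} ν W≤) = above ν (begin
    W * m              ≤⟨ ℕP.*-monoˡ-≤ m W≤ ⟩
    (A * t + e) * m    ≡⟨ ℕP.*-distribʳ-+ m (A * t) e ⟩
    A * t * m + e * m  ≡⟨ cong (_+ e * m) (ℕ*.xy∙z≈xz∙y A t m) ⟩
    A * m * t + e * m  ∎)
    where open ℕP.≤-Reasoning

  above-+ : ∀ {A W e a b} → Above A W e a → Above A W e b → Above A W e (a ℚ.+ b)
  above-+ (above {t₁} ν₁ W≤₁) (above {t₂} ν₂ W≤₂) with ℕP.≤-total t₁ t₂
  ... | inj₁ t₁≤t₂ = above (valAtLeast-+ ν₁ (valAtLeast-≤ t₁≤t₂ ν₂)) W≤₁
  ... | inj₂ t₂≤t₁ = above (valAtLeast-+ (valAtLeast-≤ t₂≤t₁ ν₁) ν₂) W≤₂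

  above-* : ∀ {A W₁ W₂ e₁ e₂ a b} → Above A W₁ e₁ a → Above A W₂ e₂ b →
    Above A (W₁ + W₂) (e₁ + e₂) (a ℚ.* b)
  above-* {A} {W₁} {W₂} {e₁} {e₂} (above {t₁} ν₁ W≤₁) (above {t₂} ν₂ W≤₂) =
    above (valAtLeast-* ν₁ ν₂) (begin
      W₁ + W₂                      ≤⟨ ℕP.+-mono-≤ W≤₁ W≤₂ ⟩
      A * t₁ + e₁ + (A * t₂ + e₂)  ≡⟨ ℕ+.interchange (A * t₁) e₁ (A * t₂) e₂ ⟩
      A * t₁ + A * t₂ + (e₁ + e₂)  ≡⟨ cong (_+ (e₁ + e₂)) (ℕP.*-distribˡ-+ A t₁ t₂) ⟨
      A * (t₁ + t₂) + (e₁ + e₂)    ∎)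
    where open ℕP.≤-Reasoning

  above⇒valAtLeast1 : ∀ {A W e a} → Above A W e a → e < W → ValAtLeast 1 a
  above⇒valAtLeast1 {A} {W} {e} (above {zero} ν W≤) e<W =
    ⊥-elim (ℕP.<⇒≱ e<W (subst (λ x → W ≤ x + e) (ℕP.*-zeroʳ A) W≤))
  above⇒valAtLeast1 (above {suc t} ν _) _ = valAtLeast-≤ (s≤s z≤n) ν

  newtonAbove-+ₚ : ∀ {A B W e} q s →
    NewtonAbove A B q W e → NewtonAbove A B s W e → NewtonAbove A B (q +ₚ s) W e
  newtonAbove-+ₚ q s hq hs k = subst (Above _ _ _) (sym (coeff-+ₚ q s k)) (above-+ (hq k) (hs k))

  newtonAbove-*ₚ : ∀ {A B W₁ W₂ e₁ e₂} .{{_ : NonZero A}} q {s} →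
    NewtonAbove A B q W₁ e₁ → NewtonAbove A B s W₂ e₂ → NewtonAbove A B (q *ₚ s) (W₁ + W₂) (e₁ + e₂)
  newtonAbove-*ₚ []      _  _  _ = above-0ℚ
  newtonAbove-*ₚ {A} {B} {W₁} {W₂} {e₁} {e₂} (a ∷ q) {s} hq hs =
    newtonAbove-+ₚ (scale a s) (0ℚ ∷ (q *ₚ s)) scaled shifted
    where
    scaled : NewtonAbove A B (scale a s) (W₁ + W₂) (e₁ + e₂)
    scaled k = subst (Above _ _ _) (sym (coeff-scale a s k))
      (above-shift (above-* (hq 0) (hs k)) (solve (W₁ ∷ W₂ ∷ e₁ ∷ e₂ ∷ k ∷ B ∷ [])))
    shifted : NewtonAbove A B (0ℚ ∷ (q *ₚ s)) (W₁ + W₂) (e₁ + e₂)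
    shifted zero    = above-0ℚ
    shifted (suc k) = above-shift (newtonAbove-*ₚ {A} {B} {W₁} {W₂} {e₁ + B} {e₂} q hq′ hs k)
      (solve (W₁ ∷ W₂ ∷ e₁ ∷ e₂ ∷ k ∷ B ∷ []))
      where
      hq′ : NewtonAbove A B q W₁ (e₁ + B)
      hq′ i = above-shift (hq (suc i)) (solve (W₁ ∷ e₁ ∷ B ∷ i ∷ []))

  newtonAbove-compose : ∀ {A B c R e} .{{_ : NonZero A}} g → NewtonAbove A B g c 0 →
    ∀ L → (∀ i → Above A R (e + i * c) (coeff L i)) → NewtonAbove A B (compose L g) R e
  newtonAbove-compose g hg []      hL k = above-0ℚ
  newtonAbove-compose {A} {B} {c} {R} {e} g hg (a ∷ L) hL =
    newtonAbove-+ₚ (a ∷ []) (g *ₚ compose L g) constant product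
    where
    constant : NewtonAbove A B (a ∷ []) R e
    constant zero    = hL 0
    constant (suc k) = above-0ℚ
    rest : NewtonAbove A B (compose L g) R (e + c)
    rest = newtonAbove-compose {A} {B} {c} {R} {e + c} g hg L
      (λ i → above-shift (hL (suc i)) (solve (R ∷ e ∷ c ∷ i ∷ [])))
    product : NewtonAbove A B (g *ₚ compose L g) R e
    product k = above-shift (newtonAbove-*ₚ {A} {B} {c} {R} {0} {e + c} g hg rest k)
      (solve (R ∷ e ∷ c ∷ k ∷ B ∷ []))

module _ where

  open import Data.Nat using (_+_; _*_)

  slope⇒line : ∀ {r n k s} → k ≤ n → r * (n ∸ k) ≤ n * s → r * n ≤ n * s + k * r
  slope⇒line {r} {n} {k} {s} k≤n h = begin
    r * n                ≡⟨ cong (r *_) (ℕP.m∸n+n≡m k≤n) ⟨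
    r * (n ∸ k + k)      ≡⟨ ℕP.*-distribˡ-+ r (n ∸ k) k ⟩
    r * (n ∸ k) + r * k  ≤⟨ ℕP.+-monoˡ-≤ (r * k) h ⟩
    n * s + r * k        ≡⟨ cong (_+_ (n * s)) (ℕP.*-comm r k) ⟩
    n * s + k * r        ∎
    where open ℕP.≤-Reasoning

  line⇒slope : ∀ {r n k t} → r * n ≤ n * t + k * r → r * (n ∸ k) ≤ n * t
  line⇒slope {r} {n} {k} {t} h = begin
    r * (n ∸ k)    ≡⟨ ℕP.*-distribˡ-∸ r n k ⟩
    r * n ∸ r * k  ≤⟨ ℕP.m≤n+o⇒m∸n≤o (r * n) (r * k) (subst (r * n ≤_) rearrange h) ⟩
    n * t          ∎
    where
    open ℕP.≤-Reasoning
    rearrange : n * t + k * r ≡ r * k + n * t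
    rearrange = trans (ℕP.+-comm (n * t) (k * r)) (cong (_+ n * t) (ℕP.*-comm k r))

PureOfDegree : ℕ → ℕ → Poly → ℕ → Set
PureOfDegree p r q n =
  HasDegree q n × ValQ p (coeff q n) (+ 0) × ValQ p (coeff q 0) (+ r) ×
  (∀ i → 1 ≤ i → i < n → SlopeOK p r n i (coeff q i))

hasDegree-unique : ∀ q {m n} → HasDegree q m → HasDegree q n → m ≡ n
hasDegree-unique _ {m} {n} (qm≢0 , above-m) (qn≢0 , above-n) with ℕP.<-cmp m n
... | tri< m<n _ _ = ⊥-elim (qn≢0 (above-m n m<n))
... | tri≈ _ m≡n _ = m≡n
... | tri> _ _ n<m = ⊥-elim (qm≢0 (above-n m n<m))

module Composition {p : ℕ} (p-prime : Prime p) (r : ℕ) where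

  open import Data.Nat using (_+_; _*_)
  open PAdic p-prime
  open NewtonPolygon p-prime

  slopeOK⇒above : ∀ {n k a} → k ≤ suc n → SlopeOK p r (suc n) k a →
    Above (suc n) (r * suc n) (k * r) a
  slopeOK⇒above _   (inj₁ refl) = above-0ℚ
  slopeOK⇒above {n} {k} k≤n (inj₂ (+ s , νa , h)) = above (valQ⇒valAtLeast νa) (slope⇒line {r} k≤n
    (ℤP.drop‿+≤+ (subst₂ ℤ._≤_ (sym (ℤP.pos-* r (suc n ∸ k))) (sym (ℤP.pos-* (suc n) s)) h)))
  slopeOK⇒above {n} {k} _ (inj₂ (-[1+ s ] , _ , h)) =
    ⊥-elim (+≰-[1+] (subst (ℤ._≤ _) (sym (ℤP.pos-* r (suc n ∸ k))) h))
    where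
    +≰-[1+] : ∀ {m j} → ¬ (+ m ℤ.≤ -[1+ j ])
    +≰-[1+] ()

  above⇒slopeOK : ∀ {n k a} → Above n (r * n) (k * r) a → a ≢ 0ℚ → SlopeOK p r n k a
  above⇒slopeOK {n} {k} (above ν bound) a≢0 with valAtLeast⇒valQ ν a≢0
  ... | s , t≤s , νa = inj₂ (+ s , νa , subst₂ ℤ._≤_ (ℤP.pos-* r (n ∸ k)) (ℤP.pos-* n s)
    (ℤ.+≤+ (ℕP.≤-trans (line⇒slope {r} {n} {k} bound) (ℕP.*-monoʳ-≤ n t≤s))))

  pure⇒newtonAbove : ∀ q {n} → PureOfDegree p r q (suc n) → NewtonAbove (suc n) r q (r * suc n) 0
  pure⇒newtonAbove _ {n} (_ , _ , const , _) zero =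
    above (valQ⇒valAtLeast const) (ℕP.≤-reflexive (trans (ℕP.*-comm r (suc n)) (sym (ℕP.+-identityʳ _))))
  pure⇒newtonAbove q {n} ((_ , beyond) , lead , _ , slopes) (suc k) with ℕP.<-cmp (suc k) (suc n)
  ... | tri< k<n _ _ = slopeOK⇒above {k = suc k} (ℕP.<⇒≤ k<n) (slopes (suc k) (s≤s z≤n) k<n)
  ... | tri≈ _ refl _ = above (valQ⇒valAtLeast lead)
    (ℕP.≤-reflexive (trans (ℕP.*-comm r (suc n)) (sym (cong (_+ suc n * r) (ℕP.*-zeroʳ (suc n))))))
  ... | tri> _ _ n<k = subst (Above _ _ _) (sym (beyond (suc k) n<k)) above-0ℚ

  pureOfDegree-0 : 1 ≤ r → ∀ q → ¬ PureOfDegree p r q 0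
  pureOfDegree-0 r≥1 _ (_ , lead , const , _) =
    ℕP.<⇒≢ r≥1 (ℤP.+-injective (valQ-unique {v = + 0} {+ r} lead const))

  pure-compose : ∀ f g {n m} → 1 ≤ r → 1 < n → PureOfDegree p r f n → PureOfDegree p r g (suc m) →
    PureOfDegree p r (compose f g) (n * suc m)
  pure-compose [] _ _ _ ((0≢0 , _) , _) _ = ⊥-elim (0≢0 refl)
  pure-compose f@(a₀ ∷ f′) g {suc n} {m} r≥1 (s≤s n≥1)
    pf@((_ , beyondf) , leadf , constf , _) pg@((_ , beyondg) , leadg , constg , _) =
    degree , lead , constant , slopes
    where
    M N R : ℕ
    M = suc m
    N = suc n * M
    R = r * suc n * M

    hg : NewtonAbove N r g (r * M) 0
    hg k = above-monoᴬ (ℕP.m≤n*m M (suc n)) (pure⇒newtonAbove g pg k)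

    hf : ∀ i → Above N R (i * (r * M)) (coeff f i)
    hf i = above-shift (above-scale M (pure⇒newtonAbove f pf i)) (cong (_+_ R) (ℕP.*-assoc i r M))

    top : TopCoeff (compose f g) N (coeff f (suc n) ℚ.* coeff g M ^ℚ suc n)
    top = topCoeff-compose g (refl , beyondg) f (suc n) (refl , beyondf)

    νlead : ValQ p (coeff f (suc n) ℚ.* coeff g M ^ℚ suc n) (+ 0)
    νlead = valExactly⇒valQ
      (valExactly-* (valQ⇒valExactly leadf) (valExactly-^ (suc n) (valQ⇒valExactly leadg)))

    degree : HasDegree (compose f g) N
    degree = (λ z → proj₁ νlead (trans (sym (proj₁ top)) z)) , proj₂ top

    lead : ValQ p (coeff (compose f g) N) (+ 0)
    lead = subst (λ x → ValQ p x (+ 0)) (sym (proj₁ top)) νlead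

    -- This is where deg f > 1 is used.
    tail≥1 : ValAtLeast 1 (coeff (compose f′ g) 0)
    tail≥1 = above⇒valAtLeast1 (newtonAbove-compose {B = r} g hg f′ (hf ∘ suc) 0) rM<R
      where
      instance
        rM≢0 : NonZero (r * M)
        rM≢0 = ℕP.m*n≢0 r M {{ℕ.>-nonZero r≥1}}
      rM<R : r * M + 0 < R
      rM<R = subst₂ _<_ (sym (ℕP.+-identityʳ (r * M))) (ℕ*.xy∙z≈xz∙y r M (suc n))
        (ℕP.m<m*n (r * M) (suc n) (s≤s n≥1))

    constant : ValQ p (coeff (compose f g) 0) (+ r)
    constant = subst (λ x → ValQ p x (+ r)) (sym (coeff-compose-0 a₀ f′ g)) (valExactly⇒valQ
      (valExactly-+ (valQ⇒valExactly constf) (valAtLeast-* tail≥1 (valQ⇒valAtLeast constg))))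

    slopes : ∀ k → 1 ≤ k → k < N → SlopeOK p r N k (coeff (compose f g) k)
    slopes k _ _ with coeff (compose f g) k ℚ.≟ 0ℚ
    ... | yes c≡0 = inj₁ c≡0
    ... | no  c≢0 = above⇒slopeOK {k = k} (above-shift (newtonAbove-compose {B = r} g hg f hf k)
      (cong (_+ k * r) (sym (ℕP.*-assoc r (suc n) M)))) c≢0

theorem3p10 : (p r : ℕ) → Prime p → 1 ≤ r → (f g : Poly) (d : ℕ) →
    Pure p r f → Pure p r g → HasDegree f d → 1 < d →
    Pure p r (compose f g)
theorem3p10 p r p-prime r≥1 f g d _ (zero , pg) _ _ =
  ⊥-elim (Composition.pureOfDegree-0 p-prime r r≥1 g pg)
theorem3p10 p r p-prime r≥1 f g d (n , pf) (suc m , pg) deg-f 1<d =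
  n ℕ.* suc m , Composition.pure-compose p-prime r f g r≥1 1<n pf pg
  where
  1<n : 1 < n
  1<n = subst (1 <_) (hasDegree-unique f deg-f (proj₁ pf)) 1<d
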